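{- For every integer $n \geq 5$, Left wins the Classic Variant of the Mixed Deletion Game played on the path $P_n$ regardless of which player moves first (i.e. $P_n > 0$ as a game).
   Context: The Classic Variant of the Mixed Deletion Game is a two-player combinatorial game between Left and Right played on a finite simple undirected graph; players alternate turns. On her turn Left deletes one vertex together with all edges incident to it; on his turn Right deletes one edge. The game ends when a deletion creates an isolated vertex (a vertex of degree $0$), and the player whose deletion created an isolated vertex loses; thus a legal move is a deletion which does not create an isolated vertex, and a player with no legal move loses. $P_n$ denotes the path graph on $n$ vertices. -}

module Defs where

open import Data.Nat using (ℕ; suc; _≡ᵇ_)
open import Data.Fin using (Fin; toℕ; _≟_)
open import Data.Bool using (Bool; true; false; _∧_; _∨_; not)
open import Data.Product using (Σ; _×_; ∃-syntax)
open import Relation.Nullary.Decidable using (⌊_⌋)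
open import Relation.Binary.PropositionalEquality using (_≡_)

-- A (finite simple) graph whose vertices are drawn from Fin n:
-- 'alive v' says v is still a vertex; 'adj u w' says uw is an edge.
-- (For the graphs arising in the game, adj is symmetric, irreflexive and
-- only relates alive vertices.)
record Graph (n : ℕ) : Set where
  constructor mkGraph
  field
    alive : Fin n → Bool
    adj   : Fin n → Fin n → Bool
open Graph public

_≠ᵇ_ : {n : ℕ} → Fin n → Fin n → Bool
x ≠ᵇ y = not ⌊ x ≟ y ⌋

deleteVertex : {n : ℕ} → Graph n → Fin n → Graph n
deleteVertex G v = mkGraph (λ x → alive G x ∧ (x ≠ᵇ v))
                           (λ x y → adj G x y ∧ (x ≠ᵇ v) ∧ (y ≠ᵇ v))

deleteEdge : {n : ℕ} → Graph n → Fin n → Fin n → Graph n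
deleteEdge G u w = mkGraph (alive G)
  (λ x y → adj G x y ∧ not ((⌊ x ≟ u ⌋ ∧ ⌊ y ≟ w ⌋) ∨ (⌊ x ≟ w ⌋ ∧ ⌊ y ≟ u ⌋)))

NoIsolated : {n : ℕ} → Graph n → Set
NoIsolated {n} G = (x : Fin n) → alive G x ≡ true → ∃[ y ] (adj G x y ≡ true)

-- Legal moves: a deletion is legal iff it does not create an isolated vertex
-- (a deletion creating an isolated vertex loses immediately, which is the same
-- as it being unavailable to the mover).
LegalLeft : {n : ℕ} → Graph n → Fin n → Set
LegalLeft G v = (alive G v ≡ true) × NoIsolated (deleteVertex G v)

LegalRight : {n : ℕ} → Graph n → Fin n → Fin n → Set
LegalRight G u w = (adj G u w ≡ true) × NoIsolated (deleteEdge G u w)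

-- Inductive, hence corresponds to winning in finitely many moves (the game is
-- finite anyway). A player with no legal move loses.
mutual
  data LeftWinsLeftFirst {n : ℕ} (G : Graph n) : Set where
    leftMove : (v : Fin n) → LegalLeft G v →
               LeftWinsRightFirst (deleteVertex G v) → LeftWinsLeftFirst G

  data LeftWinsRightFirst {n : ℕ} (G : Graph n) : Set where
    rightMoves : ((u w : Fin n) → LegalRight G u w →
                   LeftWinsLeftFirst (deleteEdge G u w)) → LeftWinsRightFirst G

LeftWinsAlways : {n : ℕ} → Graph n → Set
LeftWinsAlways G = LeftWinsLeftFirst G × LeftWinsRightFirst G

pathGraph : (n : ℕ) → Graph n
pathGraph n = mkGraph (λ _ → true)
  (λ i j → (suc (toℕ i) ≡ᵇ toℕ j) ∨ (suc (toℕ j) ≡ᵇ toℕ i))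

module Submission where

open import Defs
open import Data.Bool using (Bool; true; false; _∧_; _∨_; not; if_then_else_)
import Data.Bool as Bool
open import Data.Bool.Properties
  using (∧-assoc; ∧-comm; ∨-comm; ∧-identityʳ; ∧-zeroʳ; ∧-distribʳ-∨; ∨-zeroʳ; ¬-not)
open import Data.Empty using (⊥-elim)
open import Data.Fin using (Fin; toℕ; fromℕ<; _≟_)
open import Data.Fin.Properties using (toℕ-injective; toℕ<n; toℕ-fromℕ<)
open import Data.Nat using (ℕ; zero; suc; _≡ᵇ_; _+_; _≤_; _<_; _≥_; z≤n; s≤s; _<?_)
  renaming (_≟_ to _≟ℕ_)
open import Data.Nat.Induction using (<-wellFounded)
open import Data.Nat.Properties
  using ( ≤-refl; <-trans; ≤-<-trans; n<1+n; m<n⇒m<1+n; <⇒≢; >⇒≢; ≤∧≢⇒<; ≮⇒≥; ≰⇒>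
        ; +-mono-≤; +-mono-≤-<; m<1+n⇒m<n∨m≡n; m<1+n⇒m≤n; m≢1+n+m; anyUpTo?; _≤?_)
open import Data.Product using (∃; ∃₂; _×_; _,_; proj₁; proj₂; map₁)
open import Data.Sum using (_⊎_; inj₁; inj₂)
import Data.Sum as Sum
open import Function using (_∘_; mk⇔)
open import Induction.WellFounded using (Acc; acc)
open import Level using (0ℓ)
open import Relation.Binary.PropositionalEquality
  using (_≡_; _≢_; refl; sym; trans; cong; cong₂; subst; module ≡-Reasoning)
open import Relation.Nullary using (¬_; Dec; yes; no; does; proof; ¬?; _×-dec_; _⊎-dec_)
open import Relation.Nullary.Decidable
  using (⌊_⌋; map′; dec-true; dec-false; does-⇔; isYes≗does)
open import Relation.Nullary.Reflects using (ofʸ; ofⁿ)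
open import Relation.Unary using (Pred; Decidable)

-- A position reached from P_n never has an isolated vertex, so it is the
-- subgraph of P_n spanned by its remaining edges. A legal move of Right cuts the
-- middle edge of a path with three edges. After each of her moves Left keeps the
-- invariant that every such cut leaves a path with two edges: either no path with
-- three edges remains, or there are two edge-disjoint paths with two edges. She
-- can restore it from any position containing a path with two edges. Let p be
-- the start of the leftmost one. If no path with three edges starts right of p,
-- she deletes p. If the first one starts at k ≥ p + 2, then k starts its
-- component and she deletes k, keeping the paths at p and k + 1. If it starts at
-- p + 1, she deletes p when another path with two edges starts beyond p + 2, and
-- otherwise the component is p, …, p + 4 and she deletes p + 2, leaving only
-- single edges. Every move deletes an edge, so the play is finite; P_n with
-- n ≥ 5 has paths with two edges at 0 and at 2.

∧-true⁻ : ∀ {x y} → x ∧ y ≡ true → x ≡ true × y ≡ true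
∧-true⁻ {true} h = refl , h

∨-true⁻ : ∀ {x y} → x ∨ y ≡ true → x ≡ true ⊎ y ≡ true
∨-true⁻ {true}  _ = inj₁ refl
∨-true⁻ {false} h = inj₂ h

does⇒ : ∀ {A : Set} (a? : Dec A) → does a? ≡ true → A
does⇒ (yes a) _ = a

-- Throughout, does (a ≟ℕ b) is definitionally a ≡ᵇ b.
≡ᵇ-∧-subst : ∀ a b (f : ℕ → Bool) → (a ≡ᵇ b) ∧ f a ≡ (a ≡ᵇ b) ∧ f b
≡ᵇ-∧-subst a b f with a ≡ᵇ b | proof (a ≟ℕ b)
... | true  | ofʸ refl = refl
... | false | ofⁿ _    = refl

-- Edge sets of subgraphs of the path

-- An edge set on the vertices ℕ of the infinite path: e i = true when the
-- edge {i, i + 1} is present.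
EdgeSet : Set
EdgeSet = ℕ → Bool

_⊆ₑ_ : EdgeSet → EdgeSet → Set
e′ ⊆ₑ e = ∀ {i} → e′ i ≡ true → e i ≡ true

data Covered (e : EdgeSet) (a : ℕ) : Set where
  lowerEnd : e a ≡ true → Covered e a
  upperEnd : ∀ {i} → suc i ≡ a → e i ≡ true → Covered e a

Covered-mono : ∀ {e e′} → e′ ⊆ₑ e → ∀ {a} → Covered e′ a → Covered e a
Covered-mono sub (lowerEnd ea)    = lowerEnd (sub ea)
Covered-mono sub (upperEnd eq ei) = upperEnd eq (sub ei)

adjacent : EdgeSet → ℕ → ℕ → Bool
adjacent e a b = ((suc a ≡ᵇ b) ∧ e a) ∨ ((suc b ≡ᵇ a) ∧ e b)

adjacent⇒ : ∀ e a b → adjacent e a b ≡ true →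
            (b ≡ suc a × e a ≡ true) ⊎ (a ≡ suc b × e b ≡ true)
adjacent⇒ e a b h = Sum.map (oriented a b) (oriented b a) (∨-true⁻ h)
  where
  oriented : ∀ a b → (suc a ≡ᵇ b) ∧ e a ≡ true → b ≡ suc a × e a ≡ true
  oriented a b = map₁ (sym ∘ does⇒ (suc a ≟ℕ b)) ∘ ∧-true⁻

adjacent⇒covered : ∀ e a b → adjacent e a b ≡ true → Covered e a
adjacent⇒covered e a b h with adjacent⇒ e a b h
... | inj₁ (_ , ea)      = lowerEnd ea
... | inj₂ (a≡1+b , eb) = upperEnd (sym a≡1+b) eb

adjacent-up : ∀ e a → e a ≡ true → adjacent e a (suc a) ≡ true
adjacent-up e a ea rewrite dec-true (a ≟ℕ a) refl | ea = refl

adjacent-down : ∀ e a → e a ≡ true → adjacent e (suc a) a ≡ true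
adjacent-down e a ea rewrite dec-true (a ≟ℕ a) refl | ea = ∨-zeroʳ _

restrict : (ℕ → ℕ → Bool) → EdgeSet → EdgeSet
restrict keep e i = e i ∧ keep i (suc i)

adjacent-restrict : ∀ keep → (∀ a b → keep a b ≡ keep b a) → ∀ e a b →
                    adjacent (restrict keep e) a b ≡ adjacent e a b ∧ keep a b
adjacent-restrict keep keep-sym e a b = begin
  ((suc a ≡ᵇ b) ∧ e a ∧ keep a (suc a)) ∨ ((suc b ≡ᵇ a) ∧ e b ∧ keep b (suc b))
    ≡⟨ cong₂ _∨_ (≡ᵇ-∧-subst (suc a) b (λ c → e a ∧ keep a c))
                 (≡ᵇ-∧-subst (suc b) a (λ c → e b ∧ keep b c)) ⟩
  ((suc a ≡ᵇ b) ∧ e a ∧ keep a b) ∨ ((suc b ≡ᵇ a) ∧ e b ∧ keep b a)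
    ≡⟨ cong (λ k → ((suc a ≡ᵇ b) ∧ e a ∧ keep a b) ∨ ((suc b ≡ᵇ a) ∧ e b ∧ k)) (keep-sym b a) ⟩
  ((suc a ≡ᵇ b) ∧ e a ∧ keep a b) ∨ ((suc b ≡ᵇ a) ∧ e b ∧ keep a b)
    ≡⟨ cong₂ _∨_ (sym (∧-assoc (suc a ≡ᵇ b) (e a) _)) (sym (∧-assoc (suc b ≡ᵇ a) (e b) _)) ⟩
  (((suc a ≡ᵇ b) ∧ e a) ∧ keep a b) ∨ (((suc b ≡ᵇ a) ∧ e b) ∧ keep a b)
    ≡⟨ sym (∧-distribʳ-∨ (keep a b) ((suc a ≡ᵇ b) ∧ e a) ((suc b ≡ᵇ a) ∧ e b)) ⟩
  adjacent e a b ∧ keep a b ∎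
  where open ≡-Reasoning

vertexKept : ℕ → ℕ → ℕ → Bool
vertexKept v a b = not (a ≡ᵇ v) ∧ not (b ≡ᵇ v)

-- Opaque, so that removeVertex v e i is not unfolded when inferring v, e and i.
opaque
  removeVertex : ℕ → EdgeSet → EdgeSet
  removeVertex v = restrict (vertexKept v)

  adjacent-removeVertex : ∀ v e a b →
                          adjacent (removeVertex v e) a b ≡ adjacent e a b ∧ vertexKept v a b
  adjacent-removeVertex v = adjacent-restrict (vertexKept v) λ a b → ∧-comm (not (a ≡ᵇ v)) _

  removeVertex-⊆ : ∀ {v e} → removeVertex v e ⊆ₑ e
  removeVertex-⊆ = proj₁ ∘ ∧-true⁻

  removeVertex-avoids : ∀ {v e i} → removeVertex v e i ≡ true → i ≢ v × suc i ≢ v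
  removeVertex-avoids {v} {e} {i} h =
    does⇒ (¬? (i ≟ℕ v) ×-dec ¬? (suc i ≟ℕ v)) (proj₂ (∧-true⁻ {e i} h))

  removeVertex-keeps : ∀ {v e i} → e i ≡ true → i ≢ v → suc i ≢ v → removeVertex v e i ≡ true
  removeVertex-keeps {v} {e} {i} ei i≢v 1+i≢v
    rewrite ei = dec-true (¬? (i ≟ℕ v) ×-dec ¬? (suc i ≟ℕ v)) (i≢v , 1+i≢v)

removeVertex-removes : ∀ {v e} → removeVertex v e v ≡ false
removeVertex-removes = ¬-not λ h → proj₁ (removeVertex-avoids h) refl

removeVertex-keeps-apart : ∀ {v e i} → e i ≡ true → v < i ⊎ suc i < v → removeVertex v e i ≡ true
removeVertex-keeps-apart ei (inj₁ v<i) =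
  removeVertex-keeps ei (>⇒≢ v<i) (>⇒≢ (m<n⇒m<1+n v<i))
removeVertex-keeps-apart {i = i} ei (inj₂ 1+i<v) =
  removeVertex-keeps ei (<⇒≢ (<-trans (n<1+n i) 1+i<v)) (<⇒≢ 1+i<v)

SameEnds : ℕ → ℕ → ℕ → ℕ → Set
SameEnds u w a b = (a ≡ u × b ≡ w) ⊎ (a ≡ w × b ≡ u)

sameEnds? : ∀ u w a b → Dec (SameEnds u w a b)
sameEnds? u w a b = (a ≟ℕ u ×-dec b ≟ℕ w) ⊎-dec (a ≟ℕ w ×-dec b ≟ℕ u)

sameEnds-unique : ∀ {u w k i} → SameEnds u w k (suc k) → SameEnds u w i (suc i) → i ≡ k
sameEnds-unique (inj₁ (refl , refl)) (inj₁ (i≡k , _))        = i≡k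
sameEnds-unique (inj₁ (refl , refl)) (inj₂ (refl , 2+k≡k))   = ⊥-elim (m≢1+n+m _ (sym 2+k≡k))
sameEnds-unique (inj₂ (refl , refl)) (inj₁ (refl , 2+k≡k))   = ⊥-elim (m≢1+n+m _ (sym 2+k≡k))
sameEnds-unique (inj₂ (refl , refl)) (inj₂ (i≡k , _))        = i≡k

edgeKept : ℕ → ℕ → ℕ → ℕ → Bool
edgeKept u w a b = not (does (sameEnds? u w a b))

edgeKept-sym : ∀ u w a b → edgeKept u w a b ≡ edgeKept u w b a
edgeKept-sym u w a b =
  cong not (trans (cong₂ _∨_ (∧-comm (a ≡ᵇ u) (b ≡ᵇ w)) (∧-comm (a ≡ᵇ w) (b ≡ᵇ u)))
                  (∨-comm ((b ≡ᵇ w) ∧ (a ≡ᵇ u)) ((b ≡ᵇ u) ∧ (a ≡ᵇ w))))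

record EdgeCut (k : ℕ) (e e′ : EdgeSet) : Set where
  field
    subset : e′ ⊆ₑ e
    cut    : e′ k ≡ false
    kept   : ∀ {i} → i ≢ k → e i ≡ true → e′ i ≡ true

opaque
  removeEdge : ℕ → ℕ → EdgeSet → EdgeSet
  removeEdge u w = restrict (edgeKept u w)

  adjacent-removeEdge : ∀ u w e a b →
                        adjacent (removeEdge u w e) a b ≡ adjacent e a b ∧ edgeKept u w a b
  adjacent-removeEdge u w = adjacent-restrict (edgeKept u w) (edgeKept-sym u w)

  removeEdge-⊆ : ∀ {u w e} → removeEdge u w e ⊆ₑ e
  removeEdge-⊆ = proj₁ ∘ ∧-true⁻

  removeEdge-cut : ∀ {u w k e} → SameEnds u w k (suc k) → EdgeCut k e (removeEdge u w e)
  removeEdge-cut {u} {w} {k} {e} same = record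
    { subset = λ {i} → removeEdge-⊆ {u} {w} {e} {i}
    ; cut    = trans (cong (λ b → e k ∧ not b) (dec-true (sameEnds? u w k (suc k)) same))
                     (∧-zeroʳ (e k))
    ; kept   = λ {i} i≢k ei → trans (cong (_∧ edgeKept u w i (suc i)) ei)
                 (cong not (dec-false (sameEnds? u w i (suc i)) (i≢k ∘ sameEnds-unique same)))
    }

edgeCount : ℕ → EdgeSet → ℕ
edgeCount zero    e = 0
edgeCount (suc n) e = (if e n then 1 else 0) + edgeCount n e

module _ {e e′ : EdgeSet} (sub : e′ ⊆ₑ e) where

  indicator-mono : ∀ i → (if e′ i then 1 else 0) ≤ (if e i then 1 else 0)
  indicator-mono i with e′ i | e i | sub {i}
  ... | false | _     | _ = z≤n
  ... | true  | true  | _ = ≤-refl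
  ... | true  | false | h with h refl
  ...   | ()

  edgeCount-mono : ∀ n → edgeCount n e′ ≤ edgeCount n e
  edgeCount-mono zero    = z≤n
  edgeCount-mono (suc n) = +-mono-≤ (indicator-mono n) (edgeCount-mono n)

  edgeCount-< : ∀ {n k} → e′ k ≡ false → e k ≡ true → k < n → edgeCount n e′ < edgeCount n e
  edgeCount-< {suc n} e′k ek k<1+n with m<1+n⇒m<n∨m≡n k<1+n
  ... | inj₁ k<n  = +-mono-≤-< (indicator-mono n) (edgeCount-< e′k ek k<n)
  ... | inj₂ refl rewrite e′k | ek = s≤s (edgeCount-mono n)

Within : ℕ → EdgeSet → Set
Within n e = ∀ {i} → e i ≡ true → suc i < n

edge<n : ∀ {n e} → Within n e → ∀ {i} → e i ≡ true → i < n
edge<n inside {i} ei = <-trans (n<1+n i) (inside ei)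

-- Paths with two and three edges

record Path₂ (e : EdgeSet) (j : ℕ) : Set where
  constructor path₂
  field
    edge₀ : e j ≡ true
    edge₁ : e (suc j) ≡ true

record Path₃ (e : EdgeSet) (j : ℕ) : Set where
  constructor path₃
  field
    edge₀ : e j ≡ true
    edge₁ : e (suc j) ≡ true
    edge₂ : e (suc (suc j)) ≡ true

  lower : Path₂ e j
  lower = path₂ edge₀ edge₁

  upper : Path₂ e (suc j)
  upper = path₂ edge₁ edge₂

path₂? : ∀ e → Decidable (Path₂ e)
path₂? e j = map′ (λ (a , b) → path₂ a b) (λ (path₂ a b) → a , b)
                  ((e j Bool.≟ true) ×-dec (e (suc j) Bool.≟ true))

path₃? : ∀ e → Decidable (Path₃ e)
path₃? e j = map′ (λ (path₂ a b , c) → path₃ a b c) (λ p → Path₃.lower p , Path₃.edge₂ p)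
                  (path₂? e j ×-dec (e (suc (suc j)) Bool.≟ true))

path₃-⊆ : ∀ {e e′} → e′ ⊆ₑ e → ∀ {j} → Path₃ e′ j → Path₃ e j
path₃-⊆ sub (path₃ a b c) = path₃ (sub a) (sub b) (sub c)

path₂-cut : ∀ {c e e′ j} → EdgeCut c e e′ → Path₂ e j → j ≢ c → suc j ≢ c → Path₂ e′ j
path₂-cut cut (path₂ a b) j≢c 1+j≢c = path₂ (kept j≢c a) (kept 1+j≢c b)
  where open EdgeCut cut

path₂-removeVertex : ∀ {e v j} → Path₂ e j → v < j ⊎ suc (suc j) < v →
                     Path₂ (removeVertex v e) j
path₂-removeVertex {j = j} (path₂ a b) apart =
  path₂ (removeVertex-keeps-apart a (Sum.map₂ (<-trans (n<1+n (suc j))) apart))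
        (removeVertex-keeps-apart b (Sum.map₁ m<n⇒m<1+n apart))

DisjointPath₂s : EdgeSet → Set
DisjointPath₂s e = ∃₂ λ j k → suc j < k × Path₂ e j × Path₂ e k

-- A legal move of Right cuts the middle edge of a path with three edges (see
-- cutMiddle).
RightMovesLeavePath₂ : EdgeSet → Set
RightMovesLeavePath₂ e = ∀ {j e′} → Path₃ e j → EdgeCut (suc j) e e′ → ∃ (Path₂ e′)

noPath₃⇒rightMovesLeavePath₂ : ∀ {e} → (∀ j → ¬ Path₃ e j) → RightMovesLeavePath₂ e
noPath₃⇒rightMovesLeavePath₂ none p₃ _ = ⊥-elim (none _ p₃)

disjoint⇒rightMovesLeavePath₂ : ∀ {e} → DisjointPath₂s e → RightMovesLeavePath₂ e
disjoint⇒rightMovesLeavePath₂ (j , k , 1+j<k , pj , pk) {c} _ cut with suc c ≤? suc j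
... | yes c≤1+j = k , path₂-cut cut pk (>⇒≢ c<k) (>⇒≢ (m<n⇒m<1+n c<k))
  where c<k = ≤-<-trans c≤1+j 1+j<k
... | no  c≰1+j = j , path₂-cut cut pj (<⇒≢ (<-trans (n<1+n j) 1+j<c)) (<⇒≢ 1+j<c)
  where 1+j<c = ≰⇒> c≰1+j

-- Left's strategy

module _ {P : Pred ℕ 0ℓ} (P? : Decidable P) where

  leastWitness : ∀ {j} → P j → ∃ λ m → P m × (∀ {i} → i < m → ¬ P i)
  leastWitness {j} = descend j (<-wellFounded j)
    where
    descend : ∀ j → Acc _<_ j → P j → ∃ λ m → P m × (∀ {i} → i < m → ¬ P i)
    descend j (acc smaller) pj with anyUpTo? P? j
    ... | yes (i , i<j , pi) = descend i (smaller i<j) pi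
    ... | no  none           = j , pj , λ i<j pi → none (_ , i<j , pi)

  bounded∃? : ∀ n → (∀ {k} → P k → k < n) → Dec (∃ P)
  bounded∃? n bound =
    map′ (λ (k , _ , pk) → k , pk) (λ (k , pk) → k , bound pk , pk) (anyUpTo? P? n)

-- Deleting v does not isolate v - 1.
data LowerNeighbourSafe (e : EdgeSet) : ℕ → Set where
  atZero       : LowerNeighbourSafe e zero
  noEdgeBelow  : ∀ {u} → e u ≢ true → LowerNeighbourSafe e (suc u)
  edgeTwoBelow : ∀ {t} → e t ≡ true → LowerNeighbourSafe e (suc (suc t))

noEdgeBelow⇒safe : ∀ {e} v → (∀ {u} → suc u ≡ v → e u ≢ true) → LowerNeighbourSafe e v
noEdgeBelow⇒safe zero    _    = atZero
noEdgeBelow⇒safe (suc u) none = noEdgeBelow (none refl)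

record SafeVertex (e : EdgeSet) (v : ℕ) : Set where
  constructor safeVertex
  field
    pathUp    : Path₂ e v
    lowerSafe : LowerNeighbourSafe e v

LeftReply : EdgeSet → Set
LeftReply e = ∃ λ v → SafeVertex e v × RightMovesLeavePath₂ (removeVertex v e)

module LeftStrategy {n : ℕ} {e : EdgeSet} (inside : Within n e) where

  module FromLeftmost {p : ℕ} (pp : Path₂ e p) (leftmost : ∀ {i} → i < p → ¬ Path₂ e i) where

    leftmost-safe : SafeVertex e p
    leftmost-safe = safeVertex pp
      (noEdgeBelow⇒safe p λ { refl eu → leftmost (n<1+n _) (path₂ eu (Path₂.edge₀ pp)) })

    rightOfLeftmost : ∀ {i} → Path₂ e i → i ≢ p → p < i
    rightOfLeftmost pi i≢p = ≤∧≢⇒< (≮⇒≥ λ i<p → leftmost i<p pi) (i≢p ∘ sym)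

    LaterPath₃ : Pred ℕ 0ℓ
    LaterPath₃ k = p < k × Path₃ e k

    laterPath₃? : Decidable LaterPath₃
    laterPath₃? k = p <? k ×-dec path₃? e k

    noLaterPath₃ : ¬ ∃ LaterPath₃ → LeftReply e
    noLaterPath₃ none = p , leftmost-safe , noPath₃⇒rightMovesLeavePath₂ λ i p₃′ →
      let p₃  = path₃-⊆ removeVertex-⊆ p₃′
          i≢p = proj₁ (removeVertex-avoids (Path₃.edge₀ p₃′))
      in  none (i , rightOfLeftmost (Path₃.lower p₃) i≢p , p₃)

    fourEdgesFromLeftmost : Path₃ e (suc p) → LeftReply e
    fourEdgesFromLeftmost p₃
      with bounded∃? (λ i → suc (suc p) <? i ×-dec path₂? e i) n
                     (edge<n inside ∘ Path₂.edge₀ ∘ proj₂)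
    ... | yes (i , 2+p<i , pi) =
      p , leftmost-safe , disjoint⇒rightMovesLeavePath₂
        ( suc p , i , 2+p<i
        , path₂-removeVertex (Path₃.lower p₃) (inj₁ (n<1+n p))
        , path₂-removeVertex pi (inj₁ (<-trans (n<1+n p) (<-trans (n<1+n (suc p)) 2+p<i))))
    ... | no none =
      suc (suc p) , safeVertex (Path₃.upper p₃) (edgeTwoBelow (Path₂.edge₀ pp)) ,
      noPath₃⇒rightMovesLeavePath₂ λ i p₃′ →
        none (i , beyondSplit p₃′ , Path₃.lower (path₃-⊆ removeVertex-⊆ p₃′))
      where
      beyondSplit : ∀ {i} → Path₃ (removeVertex (suc (suc p)) e) i → suc (suc p) < i
      beyondSplit (path₃ e′i e′1i _) =
        let (i≢2+p , 1+i≢2+p) = removeVertex-avoids e′i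
            (_ , 2+i≢2+p)     = removeVertex-avoids e′1i
            p<i   = rightOfLeftmost (path₂ (removeVertex-⊆ e′i) (removeVertex-⊆ e′1i))
                                    (2+i≢2+p ∘ cong (suc ∘ suc))
            1+p<i = ≤∧≢⇒< p<i (1+i≢2+p ∘ cong suc ∘ sym)
        in  ≤∧≢⇒< 1+p<i (i≢2+p ∘ sym)

    leastLaterStartsComponent : ∀ {k} → LaterPath₃ k → (∀ {i} → i < k → ¬ LaterPath₃ i) →
                                k ≢ suc p → ∀ {u} → suc u ≡ k → e u ≢ true
    leastLaterStartsComponent (p<k , path₃ ek e1k _) earlier k≢1+p refl eu =
      earlier (n<1+n _) (≤∧≢⇒< (m<1+n⇒m≤n p<k) (k≢1+p ∘ cong suc ∘ sym) , path₃ eu ek e1k)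

    laterComponent : ∀ {k} → LaterPath₃ k → (∀ {i} → i < k → ¬ LaterPath₃ i) → k ≢ suc p →
                     LeftReply e
    laterComponent {k} later@(p<k , p₃) earlier k≢1+p =
      k , safeVertex (Path₃.lower p₃) (noEdgeBelow⇒safe k startsComponent) ,
      disjoint⇒rightMovesLeavePath₂
        ( p , suc k , s≤s p<k
        , path₂-removeVertex pp (inj₂ 2+p<k)
        , path₂-removeVertex (Path₃.upper p₃) (inj₁ (n<1+n k)))
      where
      startsComponent = leastLaterStartsComponent later earlier k≢1+p
      2+p<k : suc (suc p) < k
      2+p<k = ≤∧≢⇒< (≤∧≢⇒< p<k (k≢1+p ∘ sym)) λ 2+p≡k → startsComponent 2+p≡k (Path₂.edge₁ pp)

  leftReply : ∀ {j} → Path₂ e j → LeftReply e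
  leftReply pj with leastWitness (path₂? e) pj
  ... | p , pp , leftmost = reply (bounded∃? laterPath₃? n (edge<n inside ∘ Path₃.edge₀ ∘ proj₂))
    where
    open FromLeftmost pp leftmost
    reply : Dec (∃ LaterPath₃) → LeftReply e
    reply (no none) = noLaterPath₃ none
    reply (yes (_ , later)) with leastWitness laterPath₃? later
    ... | k , least , earlier with k ≟ℕ suc p
    ...   | yes refl  = fourEdgesFromLeftmost (proj₂ least)
    ...   | no k≢1+p = laterComponent least earlier k≢1+p

-- Game positions realised by edge sets

lowerNeighbourCovered : ∀ {e a} → LowerNeighbourSafe e (suc a) → e a ≡ true →
                        Covered (removeVertex (suc a) e) a
lowerNeighbourCovered (noEdgeBelow ¬ea)      ea = ⊥-elim (¬ea ea)
lowerNeighbourCovered (edgeTwoBelow {t} et) _  =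
  upperEnd refl (removeVertex-keeps et (<⇒≢ (m<n⇒m<1+n (n<1+n t))) (<⇒≢ (n<1+n (suc t))))

covered-removeVertex : ∀ {v e a} → SafeVertex e v → a ≢ v → Covered e a →
                       Covered (removeVertex v e) a
covered-removeVertex {v} {a = a} s a≢v (lowerEnd ea) with suc a ≟ℕ v
... | no 1+a≢v = lowerEnd (removeVertex-keeps ea a≢v 1+a≢v)
... | yes refl = lowerNeighbourCovered (SafeVertex.lowerSafe s) ea
covered-removeVertex {v} s a≢v (upperEnd {i} refl ei) with i ≟ℕ v
... | no i≢v   = upperEnd refl (removeVertex-keeps ei i≢v a≢v)
... | yes refl = lowerEnd (removeVertex-keeps (Path₂.edge₁ (SafeVertex.pathUp s)) a≢v
                                              (>⇒≢ (m<n⇒m<1+n (n<1+n v))))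

covered-removeVertex⁻ : ∀ {v e a} → Covered (removeVertex v e) a → Covered e a × a ≢ v
covered-removeVertex⁻ (lowerEnd e′a) =
  lowerEnd (removeVertex-⊆ e′a) , proj₁ (removeVertex-avoids e′a)
covered-removeVertex⁻ (upperEnd refl e′i) =
  upperEnd refl (removeVertex-⊆ e′i) , proj₂ (removeVertex-avoids e′i)

cutMiddle : ∀ {k e e′} → e k ≡ true → EdgeCut k e e′ → Covered e′ k → Covered e′ (suc k) →
            ∃ λ j → Path₃ e j × EdgeCut (suc j) e e′
cutMiddle ek cut (lowerEnd e′k) _ with trans (sym e′k) (EdgeCut.cut cut)
... | ()
cutMiddle ek cut (upperEnd refl e′j) (lowerEnd e′1k) =
  _ , path₃ (EdgeCut.subset cut e′j) ek (EdgeCut.subset cut e′1k) , cut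
cutMiddle ek cut (upperEnd refl _) (upperEnd refl e′k) with trans (sym e′k) (EdgeCut.cut cut)
... | ()

record Realises {n : ℕ} (G : Graph n) (e : EdgeSet) : Set where
  field
    adjacency     : ∀ x y → adj G x y ≡ adjacent e (toℕ x) (toℕ y)
    alive⇒covered : ∀ x → alive G x ≡ true → Covered e (toℕ x)
    covered⇒alive : ∀ x → Covered e (toℕ x) → alive G x ≡ true
    inside        : Within n e

fin-≟ : ∀ {n} (x y : Fin n) → ⌊ x ≟ y ⌋ ≡ (toℕ x ≡ᵇ toℕ y)
fin-≟ x y = trans (isYes≗does (x ≟ y))
                  (does-⇔ (mk⇔ (cong toℕ) toℕ-injective) (x ≟ y) (toℕ x ≟ℕ toℕ y))

≠ᵇ-toℕ : ∀ {n} (x y : Fin n) → (x ≠ᵇ y) ≡ not (toℕ x ≡ᵇ toℕ y)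
≠ᵇ-toℕ x y = cong not (fin-≟ x y)

module _ {n : ℕ} {G : Graph n} {e : EdgeSet} (r : Realises G e) where
  open Realises r

  neighbour : ∀ x b → b < n → adjacent e (toℕ x) b ≡ true → ∃ λ y → adj G x y ≡ true
  neighbour x b b<n h = fromℕ< b<n ,
    trans (adjacency x _) (subst (λ c → adjacent e (toℕ x) c ≡ true) (sym (toℕ-fromℕ< b<n)) h)

  noIsolated : NoIsolated G
  noIsolated x ax with alive⇒covered x ax
  ... | lowerEnd ex        = neighbour x _ (inside ex) (adjacent-up e _ ex)
  ... | upperEnd {i} eq ei =
    neighbour x i (edge<n inside ei) (subst (λ a → adjacent e a i ≡ true) eq (adjacent-down e i ei))

module _ {n : ℕ} {G : Graph n} {e : EdgeSet} (r : Realises G e) where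
  open Realises r

  realises-deleteVertex : ∀ v → SafeVertex e (toℕ v) →
                          Realises (deleteVertex G v) (removeVertex (toℕ v) e)
  realises-deleteVertex v s = record
    { adjacency     = λ x y → begin
        adj G x y ∧ (x ≠ᵇ v) ∧ (y ≠ᵇ v)
          ≡⟨ cong₂ _∧_ (adjacency x y) (cong₂ _∧_ (≠ᵇ-toℕ x v) (≠ᵇ-toℕ y v)) ⟩
        adjacent e (toℕ x) (toℕ y) ∧ vertexKept (toℕ v) (toℕ x) (toℕ y)
          ≡⟨ sym (adjacent-removeVertex (toℕ v) e (toℕ x) (toℕ y)) ⟩
        adjacent (removeVertex (toℕ v) e) (toℕ x) (toℕ y) ∎
    ; alive⇒covered = λ x h → let (ax , x≠v) = ∧-true⁻ h in
        covered-removeVertex s (≠ᵇ⇒≢ x v x≠v) (alive⇒covered x ax)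
    ; covered⇒alive = λ x c → let (c′ , x≢v) = covered-removeVertex⁻ c in
        cong₂ _∧_ (covered⇒alive x c′) (≢⇒≠ᵇ x v x≢v)
    ; inside        = inside ∘ removeVertex-⊆
    }
    where
    open ≡-Reasoning
    ≠ᵇ⇒≢ : ∀ x y → x ≠ᵇ y ≡ true → toℕ x ≢ toℕ y
    ≠ᵇ⇒≢ x y h = does⇒ (¬? (toℕ x ≟ℕ toℕ y)) (trans (sym (≠ᵇ-toℕ x y)) h)
    ≢⇒≠ᵇ : ∀ x y → toℕ x ≢ toℕ y → x ≠ᵇ y ≡ true
    ≢⇒≠ᵇ x y ne = trans (≠ᵇ-toℕ x y) (dec-true (¬? (toℕ x ≟ℕ toℕ y)) ne)

  playSafeVertex : ∀ {v} → SafeVertex e v →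
                   ∃ λ x → LegalLeft G x × Realises (deleteVertex G x) (removeVertex v e)
  playSafeVertex s@(safeVertex (path₂ ev _) _)
    with fromℕ< (edge<n inside ev) | toℕ-fromℕ< (edge<n inside ev)
  ... | x | refl = x , (covered⇒alive x (lowerEnd ev) , noIsolated r′) , r′
    where r′ = realises-deleteVertex x s

  deleteEdge-adjacency : ∀ u w x y →
    adj (deleteEdge G u w) x y ≡ adjacent (removeEdge (toℕ u) (toℕ w) e) (toℕ x) (toℕ y)
  deleteEdge-adjacency u w x y = trans
    (cong₂ _∧_ (adjacency x y)
               (cong not (cong₂ _∨_ (cong₂ _∧_ (fin-≟ x u) (fin-≟ y w))
                                    (cong₂ _∧_ (fin-≟ x w) (fin-≟ y u)))))
    (sym (adjacent-removeEdge (toℕ u) (toℕ w) e (toℕ x) (toℕ y)))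

  realises-deleteEdge : ∀ u w → NoIsolated (deleteEdge G u w) →
                        Realises (deleteEdge G u w) (removeEdge (toℕ u) (toℕ w) e)
  realises-deleteEdge u w noIsolated′ = record
    { adjacency     = deleteEdge-adjacency u w
    ; alive⇒covered = λ x ax → let (y , h) = noIsolated′ x ax in
        adjacent⇒covered _ _ (toℕ y) (trans (sym (deleteEdge-adjacency u w x y)) h)
    ; covered⇒alive = λ x → covered⇒alive x ∘ Covered-mono removeEdge-⊆
    ; inside        = inside ∘ removeEdge-⊆
    }

  rightMove : ∀ {u w} → LegalRight G u w →
              ∃₂ λ j e′ → Path₃ e j × EdgeCut (suc j) e e′ × Realises (deleteEdge G u w) e′
  rightMove {u} {w} (uw , noIsolated′) =
    Sum.[ (λ (w≡1+u , eu) → cutBetween u w w≡1+u eu (inj₁ (refl , sym w≡1+u)))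
        , (λ (u≡1+w , ew) → cutBetween w u u≡1+w ew (inj₂ (refl , sym u≡1+w))) ]′
      (adjacent⇒ e _ _ (trans (sym (adjacency u w)) uw))
    where
    e′ = removeEdge (toℕ u) (toℕ w) e
    r′ = realises-deleteEdge u w noIsolated′

    covered′ : ∀ x → Covered e (toℕ x) → Covered e′ (toℕ x)
    covered′ x = Realises.alive⇒covered r′ x ∘ covered⇒alive x

    cutBetween : ∀ lo hi → toℕ hi ≡ suc (toℕ lo) → e (toℕ lo) ≡ true →
                 SameEnds (toℕ u) (toℕ w) (toℕ lo) (suc (toℕ lo)) →
                 ∃₂ λ j e′ → Path₃ e j × EdgeCut (suc j) e e′ × Realises (deleteEdge G u w) e′
    cutBetween lo hi hi≡1+lo elo same =
      let (j , p₃ , cut) = cutMiddle elo (removeEdge-cut same) (covered′ lo (lowerEnd elo))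
                             (subst (Covered e′) hi≡1+lo (covered′ hi (upperEnd (sym hi≡1+lo) elo)))
      in  j , e′ , p₃ , cut , r′

module _ {n : ℕ} where
  mutual
    leftWinsLeftFirst : ∀ {G : Graph n} {e j} → Realises G e → Path₂ e j →
                        Acc _<_ (edgeCount n e) → LeftWinsLeftFirst G
    leftWinsLeftFirst r pj (acc smaller) =
      let (v , safe , rightMovesLeavePath₂) = LeftStrategy.leftReply (Realises.inside r) pj
          (x , legal , r′) = playSafeVertex r safe
          ev = Path₂.edge₀ (SafeVertex.pathUp safe)
      in  leftMove x legal (leftWinsRightFirst r′ rightMovesLeavePath₂
            (smaller (edgeCount-< removeVertex-⊆ removeVertex-removes ev
                                  (edge<n (Realises.inside r) ev))))

    leftWinsRightFirst : ∀ {G : Graph n} {e} → Realises G e → RightMovesLeavePath₂ e →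
                         Acc _<_ (edgeCount n e) → LeftWinsRightFirst G
    leftWinsRightFirst r rightMovesLeavePath₂ (acc smaller) = rightMoves λ u w legal →
      let (j , e′ , p₃ , cut , r′) = rightMove r legal
          (_ , p₂) = rightMovesLeavePath₂ p₃ cut
          ek = Path₃.edge₁ p₃
      in  leftWinsLeftFirst r′ p₂
            (smaller (edgeCount-< (EdgeCut.subset cut) (EdgeCut.cut cut) ek
                                  (edge<n (Realises.inside r) ek)))

pathEdges : ℕ → EdgeSet
pathEdges n i = does (suc i <? n)

pathGraph-realises : ∀ {n} → 1 < n → Realises (pathGraph n) (pathEdges n)
pathGraph-realises {n} 1<n = record
  { adjacency     = λ x y → sym (cong₂ _∨_ (towards (toℕ x) y) (towards (toℕ y) x))
  ; alive⇒covered = λ x _ → vertexCovered (toℕ x) (toℕ<n x)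
  ; covered⇒alive = λ _ _ → refl
  ; inside        = does⇒ (suc _ <? n)
  }
  where
  towards : ∀ a (y : Fin n) → (suc a ≡ᵇ toℕ y) ∧ pathEdges n a ≡ (suc a ≡ᵇ toℕ y)
  towards a y = trans (≡ᵇ-∧-subst (suc a) (toℕ y) (λ c → does (c <? n)))
                      (trans (cong ((suc a ≡ᵇ toℕ y) ∧_) (dec-true (toℕ y <? n) (toℕ<n y)))
                             (∧-identityʳ _))
  vertexCovered : ∀ a → a < n → Covered (pathEdges n) a
  vertexCovered zero    _   = lowerEnd (dec-true (1 <? n) 1<n)
  vertexCovered (suc a) a<n = upperEnd refl (dec-true (suc a <? n) a<n)

theorem3p4 : (n : ℕ) → n ≥ 5 → LeftWinsAlways (pathGraph n)
theorem3p4 n (s≤s (s≤s (s≤s (s≤s (s≤s _))))) =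
  leftWinsLeftFirst start (path₂ {j = 0} refl refl) (<-wellFounded _) ,
  leftWinsRightFirst start
    (disjoint⇒rightMovesLeavePath₂ (0 , 2 , ≤-refl , path₂ refl refl , path₂ refl refl))
    (<-wellFounded _)
  where start = pathGraph-realises (s≤s (s≤s z≤n))
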